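{- Let $q$ be a prime with $q\equiv 3\pmod 4$ and $m\ge 2$ an integer. Then the line graph $L(\Gamma(\mathbb{Z}_{q^m}[i]))$ is pancyclic.
   Context: $\mathbb{Z}_n[i]=\mathbb{Z}[i]/\langle n\rangle=\{a+bi : a,b\in\mathbb{Z}_n\}$ with $i^2=-1$. For a finite commutative ring $R$ with unity, $\Gamma(R)$ has vertex set the nonzero zero-divisors of $R$, distinct $x,y$ adjacent iff $xy=0$. The line graph $L(G)$ has the edges of $G$ as vertices, two being adjacent iff they share an endpoint in $G$. A graph of order $N$ is pancyclic if $N\ge 3$ and it contains a cycle of length $k$ for every $3\le k\le N$. -}

module Defs where

open import Level using (0ℓ)
open import Data.Nat using (ℕ; zero; suc; _+_; _*_; _∸_; _≤_; NonZero)
open import Data.Nat.DivMod using (_mod_)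
open import Data.Fin using (Fin; toℕ) renaming (zero to fzero; suc to fsuc)
open import Data.Product using (Σ; ∃; _×_; _,_; proj₁; proj₂)
open import Data.Sum using (_⊎_)
open import Relation.Binary.PropositionalEquality using (_≡_; _≢_)
open import Relation.Nullary using (¬_)

-- The ring  ℤ_n[i] = { a + b i : a , b ∈ ℤ_n },  i² = -1.
-- An element a + b i is represented by the pair (a , b) ∈ Fin n × Fin n.

module GaussianMod (n : ℕ) .{{_ : NonZero n}} where

  Zi : Set
  Zi = Fin n × Fin n

  zeroZi : Zi
  zeroZi = (0 mod n , 0 mod n)

  -- (a + b i)(c + d i) = (ac - bd) + (ad + bc) i   (mod n)
  -- subtraction mod n is realised as  ac + (n·n - bd)  since bd < n·n.
  _·_ : Zi → Zi → Zi
  (a , b) · (c , d) =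
    ( (toℕ a * toℕ c + (n * n ∸ toℕ b * toℕ d)) mod n
    , (toℕ a * toℕ d + toℕ b * toℕ c) mod n )

  IsNonzeroZeroDivisor : Zi → Set
  IsNonzeroZeroDivisor x = x ≢ zeroZi × ∃ λ y → y ≢ zeroZi × x · y ≡ zeroZi

-- Simple graphs given by a vertex type, an equivalence on it (vertex
-- identity) and an adjacency relation.

record Graph : Set₁ where
  field
    V    : Set
    _≈_  : V → V → Set
    Adj  : V → V → Set

open Graph public

next : ∀ {k} → Fin k → Fin k
next {suc k} i = (suc (toℕ i)) mod (suc k)

HasOrder : Graph → ℕ → Set
HasOrder G N = Σ (Fin N → V G) λ e →
    (∀ i j → _≈_ G (e i) (e j) → i ≡ j)
  × (∀ v → ∃ λ i → _≈_ G (e i) v)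

HasCycle : Graph → ℕ → Set
HasCycle G k = Σ (Fin k → V G) λ c →
    (∀ i j → _≈_ G (c i) (c j) → i ≡ j)
  × (∀ i → Adj G (c i) (c (next i)))

Pancyclic : Graph → Set
Pancyclic G = Σ ℕ λ N → HasOrder G N × 3 ≤ N
  × (∀ k → 3 ≤ k → k ≤ N → HasCycle G k)

ZeroDivGraph : (n : ℕ) .{{_ : NonZero n}} → Graph
ZeroDivGraph n = record
  { V   = Σ Zi IsNonzeroZeroDivisor
  ; _≈_ = λ x y → proj₁ x ≡ proj₁ y
  ; Adj = λ x y → proj₁ x ≢ proj₁ y × proj₁ x · proj₁ y ≡ zeroZi
  }
  where open GaussianMod n

-- Line graph L(G): vertices are the edges of G, i.e. ordered pairs of
-- adjacent vertices taken up to swapping the two ends; two edges are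
-- adjacent iff they are distinct and share an endpoint.

LineGraph : Graph → Graph
LineGraph G = record
  { V   = Σ (V G × V G) λ p → Adj G (proj₁ p) (proj₂ p)
  ; _≈_ = SameEdge
  ; Adj = λ e f → ¬ SameEdge e f × ShareEnd e f
  }
  where
    _~_ = _≈_ G
    SameEdge : Σ (V G × V G) (λ p → Adj G (proj₁ p) (proj₂ p))
             → Σ (V G × V G) (λ p → Adj G (proj₁ p) (proj₂ p)) → Set
    SameEdge ((x , y) , _) ((u , w) , _) = (x ~ u × y ~ w) ⊎ (x ~ w × y ~ u)
    ShareEnd : Σ (V G × V G) (λ p → Adj G (proj₁ p) (proj₂ p))
             → Σ (V G × V G) (λ p → Adj G (proj₁ p) (proj₂ p)) → Set
    ShareEnd ((x , y) , _) ((u , w) , _) = x ~ u ⊎ x ~ w ⊎ y ~ u ⊎ y ~ w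

module Submission where

open import Defs
open import Data.Nat using (ℕ; zero; suc; s≤s; _≤_; _%_; _^_)
open import Data.Nat.Properties using (m^n≢0)
open import Data.Nat.Primality using (Prime; prime⇒nonZero)
open import Relation.Binary.PropositionalEquality using (_≡_)

-- A prime p divides p C k for 0 < k < p, so the binomial theorem gives
--     the freshman's dream (1 + a)^p ≡ 1 + a^p and Fermat's little theorem; with them, a
--     prime p ≡ 3 (mod 4) dividing a² + b² divides a.
-- (2) LineGraphs.  If a simple graph Γ has two adjacent vertices u, u′ adjacent to every
--     other vertex, and some further vertex, then L(Γ) is pancyclic: its edges can be listed
--     as a Hamiltonian cycle through the edge uu′, built block by block (one block of edges
--     per vertex), and shortcutting it through uu′ after part of a block gives every length.
-- (3) GaussianIntegersModPrimePower.  If a·y = 0 with y ≠ 0 in ℤ_n[i], multiplying by the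
--     conjugate of a shows that q divides the norm of a, hence both coordinates of a by (1).
--     So every zero-divisor lies in the ideal (q), which Q and Q i annihilate: Γ(ℤ_n[i])
--     satisfies the hypothesis of (2).

module NumberTheory where

  open import Data.Nat
  open import Data.Nat.Properties
  open import Data.Nat.DivMod
  open import Data.Nat.Divisibility
  open import Data.Nat.Primality
  open import Data.Nat.Combinatorics using (_C_; nCn≡1; nCk≡n!/k![n-k]!; k![n∸k]!∣n!)
  open import Data.Nat.Tactic.RingSolver using (solve-∀)
  open import Data.Fin using (Fin; toℕ; fromℕ; inject₁) renaming (zero to fzero; suc to fsuc)
  open import Data.Fin.Properties using (toℕ-fromℕ; toℕ-inject₁; toℕ<n)
  open import Data.Vec.Functional using (tail)
  open import Data.Sum using (inj₁; inj₂; [_,_]′)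
  open import Data.Product using (_,_)
  open import Data.Empty using (⊥-elim)
  open import Relation.Nullary using (¬_)
  open import Function using (_∘_; id)
  open import Relation.Binary.PropositionalEquality
  open ≡-Reasoning
  import Algebra.Properties.CommutativeSemiring.Binomial +-*-commutativeSemiring as Binomial
  import Algebra.Properties.Monoid.Sum +-0-monoid as Sum
  open import Algebra.Definitions.RawSemiring +-*-rawSemiring using () renaming (_×_ to _×ₛ_; _^_ to _^ₛ_)

  ×≡* : ∀ n x → n ×ₛ x ≡ n * x
  ×≡* zero    x = refl
  ×≡* (suc n) x = cong (x +_) (×≡* n x)

  ^≡^ : ∀ x n → x ^ₛ n ≡ x ^ n
  ^≡^ x zero    = refl
  ^≡^ x (suc n) = cong (x *_) (^≡^ x n)

  -- The binomial theorem of the library, for (1 + a)^(1 + n), with the terms k = 0 and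
  -- k = 1 + n split off; `middleTerm n a i` is the term of index k = 1 + i, for i < n.
  binomialTerm : ℕ → ℕ → ℕ → ℕ
  binomialTerm n a k = (n C k) ×ₛ (1 ^ₛ k * a ^ₛ (n ∸ k))

  middleTerm : ∀ n a → Fin n → ℕ
  middleTerm n a i = binomialTerm (suc n) a (suc (toℕ (inject₁ i)))

  binomial-split : ∀ n a → (1 + a) ^ suc n ≡ a ^ suc n + Sum.sum (middleTerm n a) + 1
  binomial-split n a = begin
    (1 + a) ^ suc n                                      ≡⟨ ^≡^ (1 + a) (suc n) ⟨
    (1 + a) ^ₛ suc n                                     ≡⟨ Binomial.theorem (suc n) 1 a ⟩
    term 0 + Sum.sum (tail terms)                        ≡⟨ cong (term 0 +_) (Sum.sum-init-last (tail terms)) ⟩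
    term 0 + (Sum.sum (middleTerm n a) + term (toℕ (fromℕ (suc n))))
      ≡⟨ cong (λ k → term 0 + (Sum.sum (middleTerm n a) + term k)) (toℕ-fromℕ (suc n)) ⟩
    term 0 + (Sum.sum (middleTerm n a) + term (suc n))
      ≡⟨ cong₂ (λ x y → x + (Sum.sum (middleTerm n a) + y)) first-term last-term ⟩
    a ^ suc n + (Sum.sum (middleTerm n a) + 1)           ≡⟨ +-assoc (a ^ suc n) _ 1 ⟨
    a ^ suc n + Sum.sum (middleTerm n a) + 1             ∎
    where
    term : ℕ → ℕ
    term = binomialTerm (suc n) a
    terms : Fin (suc (suc n)) → ℕ
    terms = term ∘ toℕ
    first-term : term 0 ≡ a ^ suc n
    first-term = trans (+-identityʳ _) (trans (+-identityʳ _) (^≡^ a (suc n)))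
    last-term : term (suc n) ≡ 1
    last-term = begin
      (suc n C suc n) ×ₛ (1 ^ₛ suc n * a ^ₛ (n ∸ n))
        ≡⟨ cong₂ (λ c e → c ×ₛ (1 ^ₛ suc n * a ^ₛ e)) (nCn≡1 (suc n)) (n∸n≡0 n) ⟩
      1 ×ₛ (1 ^ₛ suc n * 1)
        ≡⟨ cong (λ z → z * 1 + 0) (trans (^≡^ 1 (suc n)) (^-zeroˡ (suc n))) ⟩
      1 ∎

  %-cong-+ : ∀ {d} .{{_ : NonZero d}} x x′ y y′ →
             x % d ≡ x′ % d → y % d ≡ y′ % d → (x + y) % d ≡ (x′ + y′) % d
  %-cong-+ {d} x x′ y y′ x≡x′ y≡y′ = begin
    (x + y) % d             ≡⟨ %-distribˡ-+ x y d ⟩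
    (x % d + y % d) % d     ≡⟨ cong₂ (λ u v → (u + v) % d) x≡x′ y≡y′ ⟩
    (x′ % d + y′ % d) % d   ≡⟨ %-distribˡ-+ x′ y′ d ⟨
    (x′ + y′) % d           ∎

  %-cong-* : ∀ {d} .{{_ : NonZero d}} x x′ y y′ →
             x % d ≡ x′ % d → y % d ≡ y′ % d → (x * y) % d ≡ (x′ * y′) % d
  %-cong-* {d} x x′ y y′ x≡x′ y≡y′ = begin
    (x * y) % d             ≡⟨ %-distribˡ-* x y d ⟩
    (x % d * (y % d)) % d   ≡⟨ cong₂ (λ u v → (u * v) % d) x≡x′ y≡y′ ⟩
    (x′ % d * (y′ % d)) % d ≡⟨ %-distribˡ-* x′ y′ d ⟨
    (x′ * y′) % d           ∎

  ∣-resp-% : ∀ {x y} d .{{_ : NonZero d}} → d ∣ x → x % d ≡ y % d → d ∣ y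
  ∣-resp-% {x} {y} d d∣x x≡y = m%n≡0⇒n∣m y d (trans (sym x≡y) (n∣m⇒m%n≡0 x d d∣x))

  ∣-sum : ∀ {d n} (f : Fin n → ℕ) → (∀ i → d ∣ f i) → d ∣ Sum.sum f
  ∣-sum {d} {zero}  f _      = d ∣0
  ∣-sum {d} {suc n} f d∣f    = ∣m∣n⇒∣m+n (d∣f fzero) (∣-sum (f ∘ fsuc) (d∣f ∘ fsuc))

  prime∤factorial : ∀ {p m} → Prime p → m < p → ¬ p ∣ m !
  prime∤factorial {p} {zero} p-prime _ p∣1 =
    >⇒≢ (nonTrivial⇒n>1 p {{prime⇒nonTrivial p-prime}}) (∣1⇒≡1 p∣1)
  prime∤factorial {p} {suc m} p-prime m<p p∣m! with euclidsLemma (suc m) (m !) p-prime p∣m!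
  ... | inj₁ p∣1+m = <⇒≱ m<p (∣⇒≤ p∣1+m)
  ... | inj₂ p∣m!  = prime∤factorial p-prime (≤-trans (n≤1+n (suc m)) m<p) p∣m!

  -- A prime p divides the binomial coefficients p C k for 0 < k < p,
  -- since p ∣ p! = (p C k) · k! · (p - k)! and p divides neither factorial.
  prime∣choose : ∀ {p k} → Prime p → 0 < k → k < p → p ∣ p C k
  prime∣choose {suc p-1} {k} p-prime 0<k k<p
    with euclidsLemma (suc p-1 C k) (k ! * (suc p-1 ∸ k) !) p-prime p∣factorisation
    where
    p : ℕ
    p = suc p-1
    instance _ = k !* (p ∸ k) !≢0
    p∣factorisation : p ∣ (p C k) * (k ! * (p ∸ k) !)
    p∣factorisation = subst (p ∣_)
      (sym (trans (cong (_* (k ! * (p ∸ k) !)) (nCk≡n!/k![n-k]! (<⇒≤ k<p))) (m/n*n≡m (k![n∸k]!∣n! (<⇒≤ k<p)))))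
      (m∣m*n (p-1 !))
  ... | inj₁ p∣C = p∣C
  ... | inj₂ p∣k![p-k]! with euclidsLemma (k !) ((suc p-1 ∸ k) !) p-prime p∣k![p-k]!
  ... | inj₁ p∣k! = ⊥-elim (prime∤factorial p-prime k<p p∣k!)
  ... | inj₂ p∣[p-k]! = ⊥-elim (prime∤factorial p-prime (∸-monoʳ-< 0<k (<⇒≤ k<p)) p∣[p-k]!)

  +∣odd-power-+ : ∀ x y t → x + y ∣ x ^ (1 + 2 * t) + y ^ (1 + 2 * t)
  +∣odd-power-+ x y zero =
    subst (x + y ∣_) (cong₂ _+_ (sym (*-identityʳ x)) (sym (*-identityʳ y))) ∣-refl
  +∣odd-power-+ x y (suc t) = subst (λ k → x + y ∣ x ^ k + y ^ k) (sym (exponent t)) step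
    where
    k : ℕ
    k = 1 + 2 * t
    identity : ∀ x y X Y → x * y * (X + Y) + (x * (x * X) + y * (y * Y)) ≡ (x + y) * (x * X + y * Y)
    identity = solve-∀
    step : x + y ∣ x ^ (2 + k) + y ^ (2 + k)
    step = ∣m+n∣m⇒∣n (subst (x + y ∣_) (sym (identity x y (x ^ k) (y ^ k))) (m∣m*n _))
                     (∣n⇒∣m*n (x * y) (+∣odd-power-+ x y t))
    exponent : ∀ t → 1 + 2 * suc t ≡ 2 + (1 + 2 * t)
    exponent = solve-∀

  ^-odd : ∀ a e → a ^ (1 + 2 * e) ≡ a * (a * a) ^ e
  ^-odd a e = cong (a *_) (begin
    a ^ (2 * e)  ≡⟨ ^-*-assoc a 2 e ⟨
    (a ^ 2) ^ e  ≡⟨ cong (λ x → (a * x) ^ e) (*-identityʳ a) ⟩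
    (a * a) ^ e  ∎)

  ≡3mod4⇒1+2[1+2t] : ∀ p → p % 4 ≡ 3 → p ≡ 1 + 2 * (1 + 2 * (p / 4))
  ≡3mod4⇒1+2[1+2t] p p%4≡3 = begin
    p                    ≡⟨ m≡m%n+[m/n]*n p 4 ⟩
    p % 4 + (p / 4) * 4  ≡⟨ cong (_+ (p / 4) * 4) p%4≡3 ⟩
    3 + (p / 4) * 4      ≡⟨ arithmetic (p / 4) ⟩
    1 + 2 * (1 + 2 * (p / 4)) ∎
    where
    arithmetic : ∀ t → 3 + t * 4 ≡ 1 + 2 * (1 + 2 * t)
    arithmetic = solve-∀

  module PrimeModulus {p-1 : ℕ} (p-prime : Prime (suc p-1)) where

    p : ℕ
    p = suc p-1

    -- The freshman's dream: (1 + a)^p ≡ 1 + a^p (mod p), because p divides every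
    -- middle binomial coefficient.
    frobenius : ∀ a → (1 + a) ^ p % p ≡ (1 + a ^ p) % p
    frobenius a = begin
      (1 + a) ^ p % p                                ≡⟨ cong (_% p) (binomial-split p-1 a) ⟩
      (a ^ p + Sum.sum (middleTerm p-1 a) + 1) % p   ≡⟨ cong (_% p) (shuffle (a ^ p) _) ⟩
      (Sum.sum (middleTerm p-1 a) + (1 + a ^ p)) % p ≡⟨ %-remove-+ˡ (1 + a ^ p) p∣middle ⟩
      (1 + a ^ p) % p                                ∎
      where
      shuffle : ∀ x s → x + s + 1 ≡ s + (1 + x)
      shuffle = solve-∀
      p∣middle : p ∣ Sum.sum (middleTerm p-1 a)
      p∣middle = ∣-sum (middleTerm p-1 a) λ i →
        let k = suc (toℕ (inject₁ i)) in
        subst (p ∣_) (sym (×≡* (p C k) _))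
          (∣m⇒∣m*n _ (prime∣choose p-prime (s≤s z≤n) (s≤s (subst (_< p-1) (sym (toℕ-inject₁ i)) (toℕ<n i)))))

    fermat : ∀ a → a ^ p % p ≡ a % p
    fermat zero    = refl
    fermat (suc a) = trans (frobenius a) (%-cong-+ 1 1 (a ^ p) a refl (fermat a))

    -- For p ≡ 3 (mod 4), write p = 1 + 2e.  If p ∣ a² + b², then
    -- b·a^p + a·b^p = ab ((a²)^e + (b²)^e) is divisible by a² + b², hence by p;
    -- by Fermat it is ≡ 2ab, so p ∣ 2ab.
    ∣sum-of-squares⇒∣2ab : p % 4 ≡ 3 → ∀ a b → p ∣ a * a + b * b → p ∣ 2 * (a * b)
    ∣sum-of-squares⇒∣2ab p%4≡3 a b p∣a²+b² = ∣-resp-% p p∣ba^p+ab^p (begin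
      (b * a ^ p + a * b ^ p) % p ≡⟨ %-cong-+ (b * a ^ p) (b * a) (a * b ^ p) (a * b)
                                       (%-cong-* b b (a ^ p) a refl (fermat a))
                                       (%-cong-* a a (b ^ p) b refl (fermat b)) ⟩
      (b * a + a * b) % p         ≡⟨ cong (_% p) (double a b) ⟩
      2 * (a * b) % p             ∎)
      where
      e : ℕ
      e = 1 + 2 * (p / 4)
      double : ∀ a b → b * a + a * b ≡ 2 * (a * b)
      double = solve-∀
      factor : ∀ a b A B → b * (a * A) + a * (b * B) ≡ a * b * (A + B)
      factor = solve-∀
      p∣ba^p+ab^p : p ∣ b * a ^ p + a * b ^ p
      p∣ba^p+ab^p = subst (λ k → p ∣ b * a ^ k + a * b ^ k) (sym (≡3mod4⇒1+2[1+2t] p p%4≡3))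
        (subst (p ∣_) (sym (trans (cong₂ _+_ (cong (b *_) (^-odd a e)) (cong (a *_) (^-odd b e)))
                                  (factor a b ((a * a) ^ e) ((b * b) ^ e))))
          (∣n⇒∣m*n (a * b) (∣-trans p∣a²+b² (+∣odd-power-+ (a * a) (b * b) (p / 4)))))

    ≡3mod4∣sum-of-squares⇒∣ : p % 4 ≡ 3 → ∀ a b → p ∣ a * a + b * b → p ∣ a
    ≡3mod4∣sum-of-squares⇒∣ p%4≡3 a b p∣a²+b²
      with euclidsLemma 2 (a * b) p-prime (∣sum-of-squares⇒∣2ab p%4≡3 a b p∣a²+b²)
    ... | inj₁ p∣2 = ⊥-elim (<⇒≱ (subst (_≤ p) p%4≡3 (m%n≤m p 4)) (∣⇒≤ p∣2))
    ... | inj₂ p∣ab with euclidsLemma a b p-prime p∣ab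
    ...   | inj₁ p∣a = p∣a
    ...   | inj₂ p∣b = [ id , id ]′ (euclidsLemma a a p-prime
                         (∣m+n∣m⇒∣n (subst (p ∣_) (+-comm (a * a) (b * b)) p∣a²+b²) (∣n⇒∣m*n b p∣b)))

    ∣-cancel-coprime-power : ∀ {s} → ¬ p ∣ s → ∀ m c → p ^ m ∣ s * c → p ^ m ∣ c
    ∣-cancel-coprime-power p∤s zero    c _ = 1∣ c
    ∣-cancel-coprime-power {s} p∤s (suc m) c p^[1+m]∣sc
      with euclidsLemma s c p-prime (∣-trans (m∣m*n (p ^ m)) p^[1+m]∣sc)
    ... | inj₁ p∣s = ⊥-elim (p∤s p∣s)
    ... | inj₂ (divides c′ refl) =
      subst (_∣ c′ * p) (*-comm (p ^ m) p)
        (*-monoˡ-∣ p (∣-cancel-coprime-power p∤s m c′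
          (*-cancelʳ-∣ p (subst₂ _∣_ (*-comm p (p ^ m)) (sym (*-assoc s c′ p)) p^[1+m]∣sc))))

module LineGraphs where

  open import Data.Bool using (Bool; true; false; not)
  open import Data.Nat using (ℕ; zero; suc; _+_; _%_; _≤_; z≤n; s≤s)
  open import Data.Nat.Properties
    using (suc-injective; ≤-pred; ≤-antisym; ≮⇒≥; _<?_; _≤?_; ≰⇒>; m≤n⇒∃[o]m+o≡n; +-comm; +-cancelˡ-≤;
           m≤n⇒m⊓n≡m; ≤-trans; n≤1+n; +-suc; 1+n≢n; <⇒≢; 0≢1+n; m≤n+m)
  open import Data.Nat.DivMod using (m<n⇒m%n≡m; n%n≡0)
  open import Data.Nat.Tactic.RingSolver using (solve-∀)
  open import Data.Fin using (Fin; toℕ) renaming (zero to fzero; suc to fsuc)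
  open import Data.Fin.Properties using (toℕ-fromℕ<; toℕ<n; toℕ-injective)
  open import Data.List using (List; []; _∷_; _++_; [_]; length; take; lookup)
  open import Data.List.Properties using (length-++; length-take; ++-assoc)
  open import Data.List.Membership.Propositional.Properties using (∈-lookup)
  open import Data.List.Relation.Unary.All as All using (All; []; _∷_)
  open import Data.List.Relation.Unary.Any as Any using (Any; here; there)
  open import Data.List.Relation.Unary.Any.Properties as Any using (lookup-index)
  open import Data.List.Relation.Unary.AllPairs using (AllPairs; []; _∷_)
  import Data.List.Relation.Unary.AllPairs.Properties as AllPairs
  import Data.List.Relation.Unary.All.Properties as All
  open import Data.List.Relation.Unary.Linked using (Linked; []; [-]; _∷_)
  open import Data.List.Relation.Binary.Sublist.Propositional using (_⊆_; []; _∷_; _∷ʳ_; ⊆-refl; minimum)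
  open import Data.List.Relation.Binary.Sublist.Propositional.Properties using (All-resp-⊆; take-⊆; ++⁺)
  open import Data.Product using (Σ; _×_; _,_; proj₁; proj₂)
  open import Data.Sum as Sum using (_⊎_; inj₁; inj₂)
  open import Data.Empty using (⊥; ⊥-elim)
  open import Function using (_∘_)
  open import Relation.Nullary using (¬_; yes; no; Dec)
  open import Relation.Binary.Definitions using (DecidableEquality)
  open import Relation.Binary.PropositionalEquality using (_≡_; _≢_; refl; sym; trans; cong; subst; subst₂; module ≡-Reasoning)

  AllPairs-resp-⊆ : ∀ {A : Set} {R : A → A → Set} {xs ys} → xs ⊆ ys → AllPairs R ys → AllPairs R xs
  AllPairs-resp-⊆ []          []         = []
  AllPairs-resp-⊆ (_ ∷ʳ τ)    (_ ∷ rys)  = AllPairs-resp-⊆ τ rys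
  AllPairs-resp-⊆ (refl ∷ τ)  (ry ∷ rys) = All-resp-⊆ τ ry ∷ AllPairs-resp-⊆ τ rys

  lookup-last : ∀ {A : Set} xs (z : A) (i : Fin (length (xs ++ [ z ]))) →
                suc (toℕ i) ≡ length (xs ++ [ z ]) → lookup (xs ++ [ z ]) i ≡ z
  lookup-last []       z fzero    _  = refl
  lookup-last []       z (fsuc ()) _
  lookup-last (x ∷ xs) z fzero    eq =
    ⊥-elim (0≢1+n (trans (suc-injective eq) (trans (length-++ xs) (+-comm (length xs) 1))))
  lookup-last (x ∷ xs) z (fsuc i) eq = lookup-last xs z i (suc-injective eq)

  linked-lookup : ∀ {A : Set} {R : A → A → Set} {xs} → Linked R xs →
                  ∀ i j → toℕ j ≡ suc (toℕ i) → R (lookup xs i) (lookup xs j)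
  linked-lookup (r ∷ _)  fzero    (fsuc fzero)    _  = r
  linked-lookup (_ ∷ rs) (fsuc i) (fsuc j)        eq = linked-lookup rs i j (suc-injective eq)
  linked-lookup (_ ∷ _)  fzero    (fsuc (fsuc j)) ()
  linked-lookup [-]      fzero    (fsuc ())       _

  module ListEnumeration (G : Graph) (≈-sym : ∀ {x y} → _≈_ G x y → _≈_ G y x) where

    Distinct : List (V G) → Set
    Distinct = AllPairs (λ x y → ¬ _≈_ G x y)

    lookup-injective : ∀ {xs} → Distinct xs → ∀ i j → _≈_ G (lookup xs i) (lookup xs j) → i ≡ j
    lookup-injective (_  ∷ _)  fzero    fzero    _   = refl
    lookup-injective (x≉ ∷ _)  fzero    (fsuc j) x≈y = ⊥-elim (All.lookup x≉ (∈-lookup j) x≈y)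
    lookup-injective (x≉ ∷ _)  (fsuc i) fzero    x≈y = ⊥-elim (All.lookup x≉ (∈-lookup i) (≈-sym x≈y))
    lookup-injective (_  ∷ ds) (fsuc i) (fsuc j) x≈y = cong fsuc (lookup-injective ds i j x≈y)

    hasOrder : ∀ H → Distinct H → (∀ v → Any (λ h → _≈_ G h v) H) → HasOrder G (length H)
    hasOrder H distinct covers =
      lookup H , lookup-injective distinct , λ v → Any.index (covers v) , lookup-index (covers v)

    next-cases : ∀ {k} (i : Fin (suc k)) →
                 toℕ (next i) ≡ suc (toℕ i) ⊎ (suc (toℕ i) ≡ suc k × next i ≡ fzero)
    next-cases {k} i with suc (toℕ i) <? suc k
    ... | yes i+1<k = inj₁ (trans (toℕ-fromℕ< _) (m<n⇒m%n≡m i+1<k))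
    ... | no  i+1≮k = inj₂ (i+1≡k , toℕ-injective (trans (toℕ-fromℕ< _)
                                       (trans (cong (_% suc k) i+1≡k) (n%n≡0 (suc k)))))
      where
      i+1≡k : suc (toℕ i) ≡ suc k
      i+1≡k = ≤-antisym (toℕ<n i) (≮⇒≥ i+1≮k)

    module _ (Near : V G → V G → Set) (adjacent : ∀ {x y} → ¬ _≈_ G x y → Near x y → Adj G x y) where

      hasCycle : ∀ x xs → Distinct (x ∷ xs) → 1 ≤ length xs → Linked Near (x ∷ xs) →
                 (∀ i → suc (toℕ i) ≡ length (x ∷ xs) → Near (lookup (x ∷ xs) i) x) →
                 HasCycle G (length (x ∷ xs))
      hasCycle x xs distinct 1≤|xs| linked closing = lookup (x ∷ xs) , lookup-injective distinct , step
        where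
        step : ∀ i → Adj G (lookup (x ∷ xs) i) (lookup (x ∷ xs) (next i))
        step i with next-cases i
        ... | inj₁ next≡i+1 =
          adjacent (λ i≈next → 1+n≢n (sym (trans (cong toℕ (lookup-injective distinct i (next i) i≈next)) next≡i+1)))
                   (linked-lookup linked i (next i) next≡i+1)
        ... | inj₂ (i+1≡|x∷xs| , next≡0) =
          subst (λ j → Adj G (lookup (x ∷ xs) i) (lookup (x ∷ xs) j)) (sym next≡0)
            (adjacent (λ i≈x → i≢0 (lookup-injective distinct i fzero i≈x)) (closing i i+1≡|x∷xs|))
          where
          i≢0 : i ≢ fzero
          i≢0 i≡0 = <⇒≢ 1≤|xs| (suc-injective (trans (sym (cong (suc ∘ toℕ) i≡0)) i+1≡|x∷xs|))

  SamePair : {A : Set} → A → A → A → A → Set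
  SamePair a b c d = (a ≡ c × b ≡ d) ⊎ (a ≡ d × b ≡ c)

  samePair-sym : {A : Set} {a b c d : A} → SamePair a b c d → SamePair c d a b
  samePair-sym (inj₁ (a≡c , b≡d)) = inj₁ (sym a≡c , sym b≡d)
  samePair-sym (inj₂ (a≡d , b≡c)) = inj₂ (sym b≡c , sym a≡d)

  samePair-trans : {A : Set} {a b c d e f : A} → SamePair a b c d → SamePair c d e f → SamePair a b e f
  samePair-trans (inj₁ (a≡c , b≡d)) (inj₁ (c≡e , d≡f)) = inj₁ (trans a≡c c≡e , trans b≡d d≡f)
  samePair-trans (inj₁ (a≡c , b≡d)) (inj₂ (c≡f , d≡e)) = inj₂ (trans a≡c c≡f , trans b≡d d≡e)
  samePair-trans (inj₂ (a≡d , b≡c)) (inj₁ (c≡e , d≡f)) = inj₂ (trans a≡d d≡f , trans b≡c c≡e)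
  samePair-trans (inj₂ (a≡d , b≡c)) (inj₂ (c≡f , d≡e)) = inj₁ (trans a≡d d≡e , trans b≡c c≡f)

  samePair-cancel : {A : Set} {a b c : A} → SamePair a b a c → b ≡ c
  samePair-cancel (inj₁ (_ , b≡c))     = b≡c
  samePair-cancel (inj₂ (a≡c , b≡a))   = trans b≡a a≡c

  -- The zero-divisor graph of a
  -- commutative ring has this shape, with R x y meaning x y = 0.
  module RelationGraph
    {A : Set} (_≟_ : DecidableEquality A)
    (R : A → A → Set) (R? : ∀ a b → Dec (R a b)) (R-sym : ∀ {a b} → R a b → R b a)
    (P : A → Set) where

    Vertex : Set
    Vertex = Σ A P

    Γ : Graph
    Γ = record
      { V   = Vertex
      ; _≈_ = λ x y → proj₁ x ≡ proj₁ y
      ; Adj = λ x y → proj₁ x ≢ proj₁ y × R (proj₁ x) (proj₁ y)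
      }

    DistinctVertices : List Vertex → Set
    DistinctVertices = AllPairs (λ x y → proj₁ x ≢ proj₁ y)

    Edge : Set
    Edge = V (LineGraph Γ)

    edge : (x y : Vertex) → proj₁ x ≢ proj₁ y → R (proj₁ x) (proj₁ y) → Edge
    edge x y x≢y xRy = (x , y) , x≢y , xRy

    end₁ end₂ : Edge → A
    end₁ e = proj₁ (proj₁ (proj₁ e))
    end₂ e = proj₁ (proj₂ (proj₁ e))

    -- e joins a and b.  Two edges are the same vertex of L(Γ) iff they join the same pair;
    -- `_≃_` is definitionally the vertex identification of `LineGraph Γ`.
    Joins : Edge → A → A → Set
    Joins e = SamePair (end₁ e) (end₂ e)

    _≃_ : Edge → Edge → Set
    e ≃ f = Joins e (end₁ f) (end₂ f)

    ≃-sym : ∀ {e f} → e ≃ f → f ≃ e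
    ≃-sym = samePair-sym

    joins-≃ : ∀ {e f a b} → Joins e a b → Joins f a b → e ≃ f
    joins-≃ e∼ab f∼ab = samePair-trans e∼ab (samePair-sym f∼ab)

    joins-≄ : ∀ {e f a b c} → Joins e a b → Joins f a c → b ≢ c → ¬ e ≃ f
    joins-≄ e∼ab f∼ac b≢c e≃f =
      b≢c (samePair-cancel (samePair-trans (samePair-sym e∼ab) (samePair-trans e≃f f∼ac)))

    data _∈ₑ_ (a : A) (e : Edge) : Set where
      at₁ : a ≡ end₁ e → a ∈ₑ e
      at₂ : a ≡ end₂ e → a ∈ₑ e

    ∈ₑ-resp-≃ : ∀ {a e f} → a ∈ₑ e → e ≃ f → a ∈ₑ f
    ∈ₑ-resp-≃ (at₁ a≡e₁) (inj₁ (e₁≡f₁ , _)) = at₁ (trans a≡e₁ e₁≡f₁)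
    ∈ₑ-resp-≃ (at₁ a≡e₁) (inj₂ (e₁≡f₂ , _)) = at₂ (trans a≡e₁ e₁≡f₂)
    ∈ₑ-resp-≃ (at₂ a≡e₂) (inj₁ (_ , e₂≡f₂)) = at₂ (trans a≡e₂ e₂≡f₂)
    ∈ₑ-resp-≃ (at₂ a≡e₂) (inj₂ (_ , e₂≡f₁)) = at₁ (trans a≡e₂ e₂≡f₁)

    -- The adjacency of L(Γ), apart from distinctness: a common endpoint (definitionally the
    -- `ShareEnd` of `LineGraph`).
    ShareEnd : Edge → Edge → Set
    ShareEnd e f = end₁ e ≡ end₁ f ⊎ end₁ e ≡ end₂ f ⊎ end₂ e ≡ end₁ f ⊎ end₂ e ≡ end₂ f

    share : ∀ {a e f} → a ∈ₑ e → a ∈ₑ f → ShareEnd e f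
    share (at₁ a≡e₁) (at₁ a≡f₁) = inj₁ (trans (sym a≡e₁) a≡f₁)
    share (at₁ a≡e₁) (at₂ a≡f₂) = inj₂ (inj₁ (trans (sym a≡e₁) a≡f₂))
    share (at₂ a≡e₂) (at₁ a≡f₁) = inj₂ (inj₂ (inj₁ (trans (sym a≡e₂) a≡f₁)))
    share (at₂ a≡e₂) (at₂ a≡f₂) = inj₂ (inj₂ (inj₂ (trans (sym a≡e₂) a≡f₂)))

    star-walk : ∀ {a e es f fs} → All (a ∈ₑ_) (e ∷ es) → a ∈ₑ f → Linked ShareEnd (f ∷ fs) →
                Linked ShareEnd (e ∷ es ++ f ∷ fs)
    star-walk (a∈e ∷ [])          a∈f walk = share a∈e a∈f ∷ walk
    star-walk (a∈e ∷ a∈e′ ∷ a∈es) a∈f walk = share a∈e a∈e′ ∷ star-walk (a∈e′ ∷ a∈es) a∈f walk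

    open ListEnumeration (LineGraph Γ) (λ {e} {f} → ≃-sym {e} {f}) public

    module UniversalPair
      (u u′ : Vertex) (u≢u′ : proj₁ u ≢ proj₁ u′)
      (u-universal : (v : Vertex) → R (proj₁ u) (proj₁ v)) (u′-universal : (v : Vertex) → R (proj₁ u′) (proj₁ v)) where

      hub : Bool → Vertex
      hub true  = u
      hub false = u′

      hub-universal : ∀ b (v : Vertex) → R (proj₁ (hub b)) (proj₁ v)
      hub-universal true  = u-universal
      hub-universal false = u′-universal

      hubs-differ : ∀ b → proj₁ (hub b) ≢ proj₁ (hub (not b))
      hubs-differ true  = u≢u′
      hubs-differ false = u≢u′ ∘ sym

      NonHub : Vertex → Set
      NonHub x = proj₁ x ≢ proj₁ u × proj₁ x ≢ proj₁ u′

      nonHub-≢ : ∀ {x : Vertex} → NonHub x → ∀ b → proj₁ x ≢ proj₁ (hub b)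
      nonHub-≢ (x≢u , _)  true  = x≢u
      nonHub-≢ (_ , x≢u′) false = x≢u′

      hubEdge : Edge
      hubEdge = edge u u′ u≢u′ (u-universal u′)

      hub∈hubEdge : ∀ b → proj₁ (hub b) ∈ₑ hubEdge
      hub∈hubEdge true  = at₁ refl
      hub∈hubEdge false = at₂ refl

      spoke : Bool → (x : Vertex) → NonHub x → Edge
      spoke b x x-nonHub = edge x (hub b) (nonHub-≢ {x} x-nonHub b) (R-sym (hub-universal b x))

      spoke-joins : ∀ b (x : Vertex) h → Joins (spoke b x h) (proj₁ x) (proj₁ (hub b))
      spoke-joins b x h = inj₁ (refl , refl)

      _∈⌊_⌋ : A → List Vertex → Set
      a ∈⌊ S ⌋ = Any (λ y → proj₁ y ≡ a) S

      InSpan : List Vertex → A → Set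
      InSpan S a = a ∈⌊ u ∷ u′ ∷ S ⌋

      Within : List Vertex → Edge → Set
      Within S e = InSpan S (end₁ e) × InSpan S (end₂ e)

      Separated : Vertex → List Vertex → Set
      Separated x = All (λ y → proj₁ x ≢ proj₁ y)

      separated-∉ : ∀ {x : Vertex} {S} → Separated x S → ¬ proj₁ x ∈⌊ S ⌋
      separated-∉ (x≢y ∷ _) (here y≡x)  = x≢y (sym y≡x)
      separated-∉ {x} (_ ∷ x≢S) (there x∈S) = separated-∉ {x} x≢S x∈S

      outside-span : ∀ {x : Vertex} {S} → NonHub x → Separated x S → ¬ InSpan S (proj₁ x)
      outside-span (x≢u , _)  _   (here u≡x)          = x≢u (sym u≡x)
      outside-span (_ , x≢u′) _   (there (here u′≡x)) = x≢u′ (sym u′≡x)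
      outside-span {x} _      x≢S (there (there x∈S)) = separated-∉ {x} x≢S x∈S

      ≄-within : ∀ {x : Vertex} {S e} → proj₁ x ∈ₑ e → ¬ InSpan S (proj₁ x) → ∀ {f} → Within S f → ¬ e ≃ f
      ≄-within x∈e x∉S {f} (e₁∈S , e₂∈S) e≃f with ∈ₑ-resp-≃ {f = f} x∈e e≃f
      ... | at₁ x≡f₁ = x∉S (subst (InSpan _) (sym x≡f₁) e₁∈S)
      ... | at₂ x≡f₂ = x∉S (subst (InSpan _) (sym x≡f₂) e₂∈S)

      hub-inSpan : ∀ b S → InSpan S (proj₁ (hub b))
      hub-inSpan true  S = here refl
      hub-inSpan false S = there (here refl)

      inSpan-weaken : ∀ {x S a} → InSpan S a → InSpan (x ∷ S) a
      inSpan-weaken (here u≡a)                = here u≡a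
      inSpan-weaken (there (here u′≡a))       = there (here u′≡a)
      inSpan-weaken (there (there a∈S))       = there (there (there a∈S))

      inSpan-strengthen : ∀ {x : Vertex} {S a} → InSpan (x ∷ S) a → a ≢ proj₁ x → InSpan S a
      inSpan-strengthen (here u≡a)                   _   = here u≡a
      inSpan-strengthen (there (here u′≡a))          _   = there (here u′≡a)
      inSpan-strengthen (there (there (here x≡a)))   a≢x = ⊥-elim (a≢x (sym x≡a))
      inSpan-strengthen (there (there (there a∈S)))  _   = there (there a∈S)

      nonHubs-∌hub : ∀ {S} → All NonHub S → ∀ b → ¬ proj₁ (hub b) ∈⌊ S ⌋
      nonHubs-∌hub {y ∷ _} (y-nonHub ∷ _) b (here y≡hub) = nonHub-≢ {y} y-nonHub b y≡hub
      nonHubs-∌hub (_ ∷ S-nonHub) b (there hub∈S)         = nonHubs-∌hub S-nonHub b hub∈S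

      links : (x : Vertex) (S : List Vertex) → Separated x S → List Edge
      links x []      []          = []
      links x (y ∷ S) (x≢y ∷ x≢S) with R? (proj₁ x) (proj₁ y)
      ... | yes xRy = edge x y x≢y xRy ∷ links x S x≢S
      ... | no  _   = links x S x≢S

      LinkFrom : Vertex → List Vertex → Edge → Set
      LinkFrom x S e = end₁ e ≡ proj₁ x × end₂ e ∈⌊ S ⌋

      linkFrom-joins : ∀ {x S e} → LinkFrom x S e → Joins e (proj₁ x) (end₂ e)
      linkFrom-joins (e₁≡x , _) = inj₁ (e₁≡x , refl)

      links-from : ∀ x S x≢S → All (LinkFrom x S) (links x S x≢S)
      links-from x []      []          = []
      links-from x (y ∷ S) (x≢y ∷ x≢S) with R? (proj₁ x) (proj₁ y)
      ... | yes _ = (refl , here refl) ∷ All.map (λ (e₁≡x , e₂∈S) → e₁≡x , there e₂∈S) (links-from x S x≢S)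
      ... | no  _ = All.map (λ (e₁≡x , e₂∈S) → e₁≡x , there e₂∈S) (links-from x S x≢S)

      links-distinct : ∀ x S x≢S → DistinctVertices S → Distinct (links x S x≢S)
      links-distinct x []      []          []         = []
      links-distinct x (y ∷ S) (x≢y ∷ x≢S) (y≢S ∷ dS) with R? (proj₁ x) (proj₁ y)
      ... | yes xRy = All.map (λ {f} f-link → joins-≄ {e = edge x y x≢y xRy} {f} (inj₁ (refl , refl))
                                                (linkFrom-joins {x} {S} {f} f-link)
                                                (λ y≡f₂ → separated-∉ {y} y≢S (subst (_∈⌊ S ⌋) (sym y≡f₂) (proj₂ f-link))))
                              (links-from x S x≢S)
                      ∷ links-distinct x S x≢S dS
      ... | no  _   = links-distinct x S x≢S dS

      links-complete : ∀ x S x≢S {a} → a ∈⌊ S ⌋ → R (proj₁ x) a → Any (λ f → Joins f (proj₁ x) a) (links x S x≢S)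
      links-complete x (y ∷ S) (x≢y ∷ x≢S) a∈yS xRa with R? (proj₁ x) (proj₁ y) | a∈yS
      ... | yes _   | here refl = here (inj₁ (refl , refl))
      ... | yes _   | there a∈S = there (links-complete x S x≢S a∈S xRa)
      ... | no ¬xRy | here refl = ⊥-elim (¬xRy xRa)
      ... | no _    | there a∈S = links-complete x S x≢S a∈S xRa

      -- The block of the first vertex x of S
      -- runs through all edges at x that are not yet listed: the spoke from hub b, the links
      -- from x to the rest of S, the spoke to the other hub; the tour of the rest of S then
      -- starts at that other hub.  Closing it up with hubEdge gives a Hamiltonian cycle of L(Γ).
      tour : Bool → (S : List Vertex) → DistinctVertices S → All NonHub S → List Edge
      tour b []      _          _         = []
      tour b (x ∷ S) (x≢S ∷ dS) (hx ∷ hS) =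
        spoke b x hx ∷ links x S x≢S ++ spoke (not b) x hx ∷ tour (not b) S dS hS

      tour-within : ∀ b S dS hS → All (Within S) (tour b S dS hS)
      tour-within b []      _          _         = []
      tour-within b (x ∷ S) (x≢S ∷ dS) (hx ∷ hS) =
        (x∈span , hub-inSpan b (x ∷ S))
        ∷ All.++⁺ (All.map (λ (e₁≡x , e₂∈S) → subst (InSpan (x ∷ S)) (sym e₁≡x) x∈span , there (there (there e₂∈S)))
                           (links-from x S x≢S))
                  ((x∈span , hub-inSpan (not b) (x ∷ S))
                   ∷ All.map (λ (e₁∈ , e₂∈) → inSpan-weaken e₁∈ , inSpan-weaken e₂∈) (tour-within (not b) S dS hS))
        where
        x∈span : InSpan (x ∷ S) (proj₁ x)
        x∈span = there (there (here refl))

      -- Every edge of the tour passes through a vertex of S, so differs from hubEdge.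
      tour-≄-hubEdge : ∀ b S dS hS → All (λ e → ¬ e ≃ hubEdge) (tour b S dS hS)
      tour-≄-hubEdge b []      _          _         = []
      tour-≄-hubEdge b (x ∷ S) (x≢S ∷ dS) (hx ∷ hS) =
        avoid (spoke b x hx) (at₁ refl)
        ∷ All.++⁺ (All.map (λ {e} (e₁≡x , _) → avoid e (at₁ (sym e₁≡x))) (links-from x S x≢S))
                  (avoid (spoke (not b) x hx) (at₁ refl) ∷ tour-≄-hubEdge (not b) S dS hS)
        where
        avoid : ∀ e → proj₁ x ∈ₑ e → ¬ e ≃ hubEdge
        avoid e x∈e = ≄-within {x} {[]} {e} x∈e (outside-span {x} hx []) {hubEdge} (here refl , there (here refl))

      tour-distinct : ∀ b S dS hS → Distinct (tour b S dS hS)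
      tour-distinct b []      _          _         = []
      tour-distinct b (x ∷ S) (x≢S ∷ dS) (hx ∷ hS) =
        All.++⁺ (All.map (λ {f} f-link → joins-≄ {e = spoke b x hx} {f} (spoke-joins b x hx) (linkFrom-joins {x} {S} {f} f-link)
                                            (λ hub≡f₂ → nonHubs-∌hub hS b (subst (_∈⌊ S ⌋) (sym hub≡f₂) (proj₂ f-link))))
                         (links-from x S x≢S))
                (joins-≄ {e = spoke b x hx} {spoke (not b) x hx} (spoke-joins b x hx) (spoke-joins (not b) x hx) (hubs-differ b)
                 ∷ beyond (spoke b x hx) (at₁ refl))
        ∷ AllPairs.++⁺ (links-distinct x S x≢S dS)
                       (beyond (spoke (not b) x hx) (at₁ refl) ∷ tour-distinct (not b) S dS hS)
                       (All.map (λ {f} f-link →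
                                   joins-≄ {e = f} {spoke (not b) x hx} (linkFrom-joins {x} {S} {f} f-link) (spoke-joins (not b) x hx)
                                     (λ f₂≡hub → nonHubs-∌hub hS (not b) (subst (_∈⌊ S ⌋) f₂≡hub (proj₂ f-link)))
                                 ∷ beyond f (at₁ (sym (proj₁ f-link))))
                                (links-from x S x≢S))
        where
        -- edges at x differ from all edges of the rest of the tour, which stay within S
        beyond : ∀ e → proj₁ x ∈ₑ e → All (λ f → ¬ e ≃ f) (tour (not b) S dS hS)
        beyond e x∈e = All.map (λ {f} → ≄-within {x} {S} {e} x∈e (outside-span {x} hx x≢S) {f}) (tour-within (not b) S dS hS)

      spoke-in-block : ∀ b c x S x≢S dS hx hS {e} → e ≃ spoke c x hx →
                       Any (e ≃_) (tour b (x ∷ S) (x≢S ∷ dS) (hx ∷ hS))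
      spoke-in-block true  true  x S x≢S dS hx hS e≃spoke = here e≃spoke
      spoke-in-block false false x S x≢S dS hx hS e≃spoke = here e≃spoke
      spoke-in-block true  false x S x≢S dS hx hS e≃spoke = there (Any.++⁺ʳ (links x S x≢S) (here e≃spoke))
      spoke-in-block false true  x S x≢S dS hx hS e≃spoke = there (Any.++⁺ʳ (links x S x≢S) (here e≃spoke))

      block-complete : ∀ b x S x≢S dS hx hS {e o} → Joins e (proj₁ x) o → InSpan (x ∷ S) o → o ≢ proj₁ x →
                       R (proj₁ x) o → Any (e ≃_) (tour b (x ∷ S) (x≢S ∷ dS) (hx ∷ hS))
      block-complete b x S x≢S dS hx hS {e} e∼xo (here u≡o) _ _ =
        spoke-in-block b true x S x≢S dS hx hS {e}
          (joins-≃ {e} {spoke true x hx} e∼xo (subst (Joins (spoke true x hx) (proj₁ x)) u≡o (spoke-joins true x hx)))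
      block-complete b x S x≢S dS hx hS {e} e∼xo (there (here u′≡o)) _ _ =
        spoke-in-block b false x S x≢S dS hx hS {e}
          (joins-≃ {e} {spoke false x hx} e∼xo (subst (Joins (spoke false x hx) (proj₁ x)) u′≡o (spoke-joins false x hx)))
      block-complete b x S x≢S dS hx hS e∼xo (there (there (here x≡o))) o≢x _ = ⊥-elim (o≢x (sym x≡o))
      block-complete b x S x≢S dS hx hS {e} e∼xo (there (there (there o∈S))) _ xRo =
        there (Any.++⁺ˡ (Any.map (λ {f} f∼xo → joins-≃ {e} {f} e∼xo f∼xo) (links-complete x S x≢S o∈S xRo)))

      tour-complete : ∀ b S dS hS e → Within S e → e ≃ hubEdge ⊎ Any (e ≃_) (tour b S dS hS)
      tour-complete b [] _ _ e (here u≡e₁ , here u≡e₂)                   = ⊥-elim (proj₁ (proj₂ e) (trans (sym u≡e₁) u≡e₂))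
      tour-complete b [] _ _ e (here u≡e₁ , there (here u′≡e₂))          = inj₁ (inj₁ (sym u≡e₁ , sym u′≡e₂))
      tour-complete b [] _ _ e (there (here u′≡e₁) , here u≡e₂)          = inj₁ (inj₂ (sym u′≡e₁ , sym u≡e₂))
      tour-complete b [] _ _ e (there (here u′≡e₁) , there (here u′≡e₂)) =
        ⊥-elim (proj₁ (proj₂ e) (trans (sym u′≡e₁) u′≡e₂))
      tour-complete b (x ∷ S) (x≢S ∷ dS) (hx ∷ hS) e (e₁∈ , e₂∈) with end₁ e ≟ proj₁ x | end₂ e ≟ proj₁ x
      ... | yes e₁≡x | _ =
        inj₂ (block-complete b x S x≢S dS hx hS {e} (inj₁ (e₁≡x , refl)) e₂∈
                             (λ e₂≡x → proj₁ (proj₂ e) (trans e₁≡x (sym e₂≡x)))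
                             (subst (λ a → R a (end₂ e)) e₁≡x (proj₂ (proj₂ e))))
      ... | no _ | yes e₂≡x =
        inj₂ (block-complete b x S x≢S dS hx hS {e} (inj₂ (refl , e₂≡x)) e₁∈
                             (λ e₁≡x → proj₁ (proj₂ e) (trans e₁≡x (sym e₂≡x)))
                             (subst (λ a → R a (end₁ e)) e₂≡x (R-sym (proj₂ (proj₂ e)))))
      ... | no e₁≢x | no e₂≢x =
        Sum.map₂ (there ∘ Any.++⁺ʳ (links x S x≢S) ∘ there)
                 (tour-complete (not b) S dS hS e (inSpan-strengthen {x} e₁∈ e₁≢x , inSpan-strengthen {x} e₂∈ e₂≢x))

      StartsAt : A → List Edge → Set
      StartsAt a []      = ⊥
      StartsAt a (e ∷ _) = a ∈ₑ e

      record HubPath (b : Bool) (L : List Edge) (k : ℕ) : Set where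
        field
          body          : List Edge
          length-body   : length body ≡ k
          body⊆L        : body ⊆ L
          starts-at-hub : StartsAt (proj₁ (hub b)) body
          walk          : Linked ShareEnd (body ++ [ hubEdge ])

      prepend : ∀ {c f} body → proj₁ (hub c) ∈ₑ f → StartsAt (proj₁ (hub c)) body →
                Linked ShareEnd (body ++ [ hubEdge ]) → Linked ShareEnd (f ∷ body ++ [ hubEdge ])
      prepend (e ∷ _) c∈f c∈e walk = share c∈f c∈e ∷ walk

      links-at : ∀ x S x≢S → All (proj₁ x ∈ₑ_) (links x S x≢S)
      links-at x S x≢S = All.map (λ (e₁≡x , _) → at₁ (sym e₁≡x)) (links-from x S x≢S)

      truncated-block : ∀ b x S x≢S dS hx hS s → s ≤ length (links x S x≢S) →
                        HubPath b (tour b (x ∷ S) (x≢S ∷ dS) (hx ∷ hS)) (2 + s)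
      truncated-block b x S x≢S dS hx hS s s≤|links| = record
        { body          = spoke b x hx ∷ take s ls ++ [ spoke (not b) x hx ]
        ; length-body   = cong suc (begin
            length (take s ls ++ [ spoke (not b) x hx ]) ≡⟨ length-++ (take s ls) ⟩
            length (take s ls) + 1                       ≡⟨ cong (_+ 1) (trans (length-take s ls) (m≤n⇒m⊓n≡m s≤|links|)) ⟩
            s + 1                                        ≡⟨ +-comm s 1 ⟩
            suc s                                        ∎)
        ; body⊆L        = refl ∷ ++⁺ (take-⊆ s ls) (refl ∷ minimum _)
        ; starts-at-hub = at₂ refl
        ; walk          = subst (Linked ShareEnd) (cong (spoke b x hx ∷_) (sym (++-assoc (take s ls) _ _)))
                            (star-walk (at₁ refl ∷ All.take⁺ s (links-at x S x≢S)) (at₁ refl)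
                                       (share {e = spoke (not b) x hx} (at₂ refl) (hub∈hubEdge (not b)) ∷ [-]))
        }
        where
        open ≡-Reasoning
        ls = links x S x≢S

      whole-block-then : ∀ b x S x≢S dS hx hS {k} → HubPath (not b) (tour (not b) S dS hS) k →
                         HubPath b (tour b (x ∷ S) (x≢S ∷ dS) (hx ∷ hS)) (suc (length (links x S x≢S) + suc k))
      whole-block-then b x S x≢S dS hx hS path = record
        { body          = spoke b x hx ∷ ls ++ spoke (not b) x hx ∷ body
        ; length-body   = cong suc (trans (length-++ ls) (cong (λ n → length ls + suc n) length-body))
        ; body⊆L        = refl ∷ ++⁺ ⊆-refl (refl ∷ body⊆L)
        ; starts-at-hub = at₂ refl
        ; walk          = subst (Linked ShareEnd) (cong (spoke b x hx ∷_) (sym (++-assoc ls _ _)))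
                            (star-walk (at₁ refl ∷ links-at x S x≢S) (at₁ refl)
                                       (prepend body (at₂ refl) starts-at-hub walk))
        }
        where
        open HubPath path
        ls = links x S x≢S

      -- Every length 1 ≤ k ≤ |tour b S| is realised: by the first spoke alone, by a truncated
      -- first block, or by the whole first block followed by a shorter walk.
      hubPath : ∀ b S dS hS k → 1 ≤ k → k ≤ length (tour b S dS hS) → HubPath b (tour b S dS hS) k
      hubPath b []      _          _         (suc k)       _ ()
      hubPath b (x ∷ S) (x≢S ∷ dS) (hx ∷ hS) (suc zero)    _ _ = record
        { body          = spoke b x hx ∷ []
        ; length-body   = refl
        ; body⊆L        = refl ∷ minimum _
        ; starts-at-hub = at₂ refl
        ; walk          = share {e = spoke b x hx} (at₂ refl) (hub∈hubEdge b) ∷ [-]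
        }
      hubPath b (x ∷ S) (x≢S ∷ dS) (hx ∷ hS) (suc (suc s)) _ k≤|tour| with s ≤? length (links x S x≢S)
      ... | yes s≤|links| = truncated-block b x S x≢S dS hx hS s s≤|links|
      ... | no  s≰|links| with m≤n⇒∃[o]m+o≡n (≰⇒> s≰|links|)
      ...   | t , refl =
        subst (HubPath b _) (regroup (length ls) t)
              (whole-block-then b x S x≢S dS hx hS (hubPath (not b) S dS hS (suc t) (s≤s z≤n) bound))
        where
        ls = links x S x≢S
        regroup : ∀ L t → suc (L + suc (suc t)) ≡ suc (suc (suc L + t))
        regroup = solve-∀
        shift : ∀ L t → suc (suc L + t) ≡ L + suc (suc t)
        shift = solve-∀
        bound : suc t ≤ length (tour (not b) S dS hS)
        bound = ≤-pred (+-cancelˡ-≤ (length ls) _ _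
                  (subst₂ _≤_ (shift (length ls) t) (length-++ ls) (≤-pred k≤|tour|)))

      tour-length≥2 : ∀ b S dS hS → 1 ≤ length S → 2 ≤ length (tour b S dS hS)
      tour-length≥2 b (x ∷ S) (x≢S ∷ dS) (hx ∷ hS) _ =
        s≤s (subst (1 ≤_) (sym (length-++ (links x S x≢S)))
                   (≤-trans (s≤s z≤n) (m≤n+m (suc (length (tour (not b) S dS hS))) (length (links x S x≢S)))))

      pancyclic : ∀ X (dX : DistinctVertices X) (hX : All NonHub X) →
                  ((v : Vertex) → NonHub v → proj₁ v ∈⌊ X ⌋) → 1 ≤ length X → Pancyclic (LineGraph Γ)
      pancyclic X dX hX covers 1≤|X| = length H , hasOrder H H-distinct H-covers , 3≤|H| , cycle
        where
        T H : List Edge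
        T = tour true X dX hX
        H = T ++ [ hubEdge ]

        H-distinct : Distinct H
        H-distinct = AllPairs.++⁺ (tour-distinct true X dX hX) ([] ∷ []) (All.map (_∷ []) (tour-≄-hubEdge true X dX hX))

        in-span : (v : Vertex) → InSpan X (proj₁ v)
        in-span v with proj₁ v ≟ proj₁ u | proj₁ v ≟ proj₁ u′
        ... | yes v≡u | _        = here (sym v≡u)
        ... | no _    | yes v≡u′ = there (here (sym v≡u′))
        ... | no v≢u  | no v≢u′  = there (there (covers v (v≢u , v≢u′)))

        H-covers : ∀ e → Any (_≃ e) H
        H-covers e with tour-complete true X dX hX e (in-span (proj₁ (proj₁ e)) , in-span (proj₂ (proj₁ e)))
        ... | inj₁ e≃hubEdge = Any.++⁺ʳ T (here (≃-sym {e} {hubEdge} e≃hubEdge))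
        ... | inj₂ e∈T       = Any.++⁺ˡ (Any.map (λ {f} → ≃-sym {e} {f}) e∈T)

        |H|≡|T|+1 : length H ≡ suc (length T)
        |H|≡|T|+1 = trans (length-++ T) (+-comm (length T) 1)

        3≤|H| : 3 ≤ length H
        3≤|H| = subst (3 ≤_) (sym |H|≡|T|+1) (s≤s (tour-length≥2 true X dX hX 1≤|X|))

        cycle : ∀ k → 3 ≤ k → k ≤ length H → HasCycle (LineGraph Γ) k
        cycle (suc k) (s≤s 2≤k) k+1≤|H| = closed-walk (hubPath true X dX hX k (≤-trans (s≤s z≤n) 2≤k)
                                                        (≤-pred (subst (suc k ≤_) |H|≡|T|+1 k+1≤|H|)))
          where
          -- the walk followed by hubEdge is a cycle, as hubEdge meets its first edge at u
          closed-walk : HubPath true T k → HasCycle (LineGraph Γ) (suc k)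
          closed-walk record { body = e ∷ es ; length-body = refl ; body⊆L = es⊆T ; starts-at-hub = u∈e ; walk = walk } =
            subst (HasCycle (LineGraph Γ)) (cong suc (trans (length-++ es) (+-comm (length es) 1)))
              (hasCycle ShareEnd _,_ e (es ++ [ hubEdge ])
                 (AllPairs-resp-⊆ (++⁺ es⊆T ⊆-refl) H-distinct)
                 (subst (1 ≤_) (sym (trans (length-++ es) (+-comm (length es) 1))) (s≤s z≤n))
                 walk
                 (λ i last → subst (λ f → ShareEnd f e) (sym (lookup-last (e ∷ es) hubEdge i last))
                                   (share (hub∈hubEdge true) u∈e)))

-- The ring ℤ_n[i] for n = q^m, q ≡ 3 (mod 4) prime, m = k + 2 ≥ 2.
module GaussianIntegersModPrimePower
  {q-1 k : ℕ} (q-prime : Prime (suc q-1)) (q≡3mod4 : suc q-1 % 4 ≡ 3) where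

  open NumberTheory using (module PrimeModulus)
  open LineGraphs using (module RelationGraph)
  open import Data.Nat
  open import Data.Nat.Properties
  open import Data.Nat.DivMod
  open import Data.Nat.Divisibility
  open import Data.Nat.Primality
  open import Data.Nat.Tactic.RingSolver using (solve-∀)
  open import Data.Fin using (Fin; toℕ) renaming (_≟_ to _≟Fin_)
  open import Data.Fin.Properties using (toℕ<n; toℕ-injective; toℕ-fromℕ<)
  open import Data.List using (List; []; _∷_; length; allFin; cartesianProduct)
  open import Data.List.Relation.Unary.All as All using (All; []; _∷_)
  open import Data.List.Relation.Unary.Any using (here; there)
  open import Data.List.Relation.Unary.AllPairs using ([]; _∷_)
  open import Data.List.Membership.Propositional using (_∈_)
  open import Data.List.Membership.Propositional.Properties using (∈-allFin; ∈-cartesianProduct⁺)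
  open import Data.List.Relation.Unary.Unique.Propositional using (Unique)
  import Data.List.Relation.Unary.Unique.Propositional.Properties as Unique
  open import Data.Product using (_×_; _,_; proj₁; proj₂)
  open import Data.Product.Properties using (≡-dec)
  open import Data.Empty using (⊥-elim)
  open import Function using (_∘_)
  open import Relation.Nullary using (¬_; yes; no; Dec)
  open import Relation.Nullary.Decidable using (_×-dec_; ¬?)
  open import Relation.Binary.PropositionalEquality using (_≡_; _≢_; refl; sym; trans; cong; cong₂; subst; subst₂)

  q Q n : ℕ
  q = suc q-1
  Q = q ^ suc k
  n = q * Q

  instance
    n≢0 : NonZero n
    n≢0 = m^n≢0 q (suc (suc k))

  open GaussianMod n
  open PrimeModulus q-prime using (≡3mod4∣sum-of-squares⇒∣; ∣-cancel-coprime-power)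

  [_] : ℕ → Fin n
  [ a ] = a mod n

  toℕ-[] : ∀ a → toℕ [ a ] ≡ a % n
  toℕ-[] a = toℕ-fromℕ< _

  [0] : Fin n
  [0] = [ 0 ]

  toℕ-[0] : toℕ [0] ≡ 0
  toℕ-[0] = trans (toℕ-[] 0) (n∣m⇒m%n≡0 0 n (n ∣0))

  n∣⇒[]≡0 : ∀ a → n ∣ a → [ a ] ≡ [0]
  n∣⇒[]≡0 a n∣a = toℕ-injective (trans (toℕ-[] a) (trans (n∣m⇒m%n≡0 a n n∣a) (sym toℕ-[0])))

  []≡0⇒n∣ : ∀ a → [ a ] ≡ [0] → n ∣ a
  []≡0⇒n∣ a [a]≡0 = m%n≡0⇒n∣m a n (trans (sym (toℕ-[] a)) (trans (cong toℕ [a]≡0) toℕ-[0]))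

  _≟Zi_ : (x y : Zi) → Dec (x ≡ y)
  _≟Zi_ = ≡-dec _≟Fin_ _≟Fin_

  ·-comm : ∀ x y → x · y ≡ y · x
  ·-comm (a , b) (c , d) = cong₂ _,_
    (cong [_] (cong₂ _+_ (*-comm (toℕ a) (toℕ c)) (cong (n * n ∸_) (*-comm (toℕ b) (toℕ d)))))
    (cong [_] (trans (+-comm (toℕ a * toℕ d) _) (cong₂ _+_ (*-comm (toℕ b) (toℕ c)) (*-comm (toℕ a) (toℕ d)))))

  InIdeal : Zi → Set
  InIdeal (a , b) = q ∣ toℕ a × q ∣ toℕ b

  n∣Q* : ∀ a → q ∣ a → n ∣ Q * a
  n∣Q* .(j * q) (divides-refl j) = divides j (regroup Q j q)
    where
    regroup : ∀ Q j q → Q * (j * q) ≡ j * (q * Q)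
    regroup = solve-∀

  u₀ u₀′ : Zi
  u₀  = [ Q ] , [0]
  u₀′ = [0] , [ Q ]

  toℕ-[Q] : toℕ [ Q ] ≡ Q
  toℕ-[Q] = trans (toℕ-[] Q) (m<n⇒m%n≡m Q<n)
    where
    Q<n : Q < n
    Q<n = subst (Q <_) (*-comm Q q)
            (m<m*n Q q {{>-nonZero (m^n>0 q (suc k))}} (nonTrivial⇒n>1 q {{prime⇒nonTrivial q-prime}}))

  [Q]≢0 : [ Q ] ≢ [0]
  [Q]≢0 [Q]≡0 = >⇒≢ (m^n>0 q (suc k)) (trans (sym toℕ-[Q]) (trans (cong toℕ [Q]≡0) toℕ-[0]))

  u₀≢0 : u₀ ≢ zeroZi
  u₀≢0 = [Q]≢0 ∘ cong proj₁

  u₀′≢0 : u₀′ ≢ zeroZi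
  u₀′≢0 = [Q]≢0 ∘ cong proj₂

  u₀≢u₀′ : u₀ ≢ u₀′
  u₀≢u₀′ = [Q]≢0 ∘ cong proj₁

  u₀∈ideal : InIdeal u₀
  u₀∈ideal = subst (q ∣_) (sym toℕ-[Q]) (m∣m*n (q ^ k)) , subst (q ∣_) (sym toℕ-[0]) (q ∣0)

  u₀-annihilates : ∀ w → InIdeal w → u₀ · w ≡ zeroZi
  u₀-annihilates (a , b) (q∣a , q∣b) = cong₂ _,_
    (n∣⇒[]≡0 _ (subst (λ x → n ∣ x * toℕ a + (n * n ∸ toℕ [0] * toℕ b)) (sym toℕ-[Q])
                 (subst (λ z → n ∣ Q * toℕ a + (n * n ∸ z * toℕ b)) (sym toℕ-[0])
                   (∣m∣n⇒∣m+n (n∣Q* (toℕ a) q∣a) (m∣m*n n)))))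
    (n∣⇒[]≡0 _ (subst₂ (λ x z → n ∣ x * toℕ b + z * toℕ a) (sym toℕ-[Q]) (sym toℕ-[0])
                 (subst (n ∣_) (sym (+-identityʳ (Q * toℕ b))) (n∣Q* (toℕ b) q∣b))))

  u₀′-annihilates : ∀ w → InIdeal w → u₀′ · w ≡ zeroZi
  u₀′-annihilates (a , b) (q∣a , q∣b) = cong₂ _,_
    (n∣⇒[]≡0 _ (subst₂ (λ z x → n ∣ z * toℕ a + (n * n ∸ x * toℕ b)) (sym toℕ-[0]) (sym toℕ-[Q])
                 (n∣n²∸ (n∣Q* (toℕ b) q∣b))))
    (n∣⇒[]≡0 _ (subst₂ (λ z x → n ∣ z * toℕ b + x * toℕ a) (sym toℕ-[0]) (sym toℕ-[Q]) (n∣Q* (toℕ a) q∣a)))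
    where
    n∣n²∸ : ∀ {x} → n ∣ x → n ∣ n * n ∸ x
    n∣n²∸ (divides-refl j) = subst (n ∣_) (*-distribʳ-∸ n n j) (n∣m*n (n ∸ j))

  -- Multiplying a · y = 0 by the conjugate of a = a₁ + a₂ i shows that the norm
  -- a₁² + a₂² kills both coordinates of y modulo n.
  norm-kills : ∀ a y → a · y ≡ zeroZi →
               let s = toℕ (proj₁ a) * toℕ (proj₁ a) + toℕ (proj₂ a) * toℕ (proj₂ a)
               in n ∣ s * toℕ (proj₁ y) × n ∣ s * toℕ (proj₂ y)
  norm-kills (A₁ , A₂) (C , D) ay≡0 = n∣sc , n∣sd
    where
    a₁ a₂ c d s d′ : ℕ
    a₁ = toℕ A₁
    a₂ = toℕ A₂
    c  = toℕ C
    d  = toℕ D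
    s  = a₁ * a₁ + a₂ * a₂
    d′ = n * n ∸ a₂ * d             -- stands for - a₂ d in the real part
    d′+a₂d≡n² : d′ + a₂ * d ≡ n * n
    d′+a₂d≡n² = m∸n+n≡m (*-mono-≤ (<⇒≤ (toℕ<n A₂)) (<⇒≤ (toℕ<n D)))
    n∣re : n ∣ a₁ * c + d′
    n∣re = []≡0⇒n∣ _ (cong proj₁ ay≡0)
    n∣im : n ∣ a₁ * d + a₂ * c
    n∣im = []≡0⇒n∣ _ (cong proj₂ ay≡0)
    conj-re : ∀ a₁ a₂ c d d′ → a₁ * (a₁ * c + d′) + a₂ * (a₁ * d + a₂ * c)
                             ≡ a₁ * (d′ + a₂ * d) + (a₁ * a₁ + a₂ * a₂) * c
    conj-re = solve-∀
    conj-im : ∀ a₁ a₂ c d d′ → a₁ * (a₁ * d + a₂ * c) + a₂ * (d′ + a₂ * d)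
                             ≡ a₂ * (a₁ * c + d′) + (a₁ * a₁ + a₂ * a₂) * d
    conj-im = solve-∀
    n∣sc : n ∣ s * c
    n∣sc = ∣m+n∣m⇒∣n (subst (n ∣_) (trans (conj-re a₁ a₂ c d d′) (cong (λ z → a₁ * z + s * c) d′+a₂d≡n²))
                                   (∣m∣n⇒∣m+n (∣n⇒∣m*n a₁ n∣re) (∣n⇒∣m*n a₂ n∣im)))
                     (∣n⇒∣m*n a₁ (m∣m*n n))
    n∣sd : n ∣ s * d
    n∣sd = ∣m+n∣m⇒∣n (subst (n ∣_) (conj-im a₁ a₂ c d d′)
                                   (∣m∣n⇒∣m+n (∣n⇒∣m*n a₁ n∣im)
                                              (subst (λ z → n ∣ a₂ * z) (sym d′+a₂d≡n²) (∣n⇒∣m*n a₂ (m∣m*n n)))))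
                     (∣n⇒∣m*n a₂ n∣re)

  killed-by-unit : ∀ {s} (c : Fin n) → ¬ q ∣ s → n ∣ s * toℕ c → c ≡ [0]
  killed-by-unit c q∤s n∣sc =
    toℕ-injective (trans (<-zero (toℕ c) (∣-cancel-coprime-power q∤s (suc (suc k)) (toℕ c) n∣sc) (toℕ<n c))
                         (sym toℕ-[0]))
    where
    <-zero : ∀ x → n ∣ x → x < n → x ≡ 0
    <-zero zero    _   _   = refl
    <-zero (suc x) n∣x x<n = ⊥-elim (<⇒≱ x<n (∣⇒≤ n∣x))

  -- Every zero-divisor of ℤ_n[i] lies in the ideal (q): if q ∤ a₁² + a₂² then
  -- `norm-kills` forces y = 0; otherwise q ∣ a₁, a₂ because q ≡ 3 (mod 4).
  zeroDivisor∈ideal : ∀ a y → y ≢ zeroZi → a · y ≡ zeroZi → InIdeal a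
  zeroDivisor∈ideal a@(A₁ , A₂) y@(C , D) y≢0 ay≡0 with q ∣? (toℕ A₁ * toℕ A₁ + toℕ A₂ * toℕ A₂)
  ... | yes q∣s = ≡3mod4∣sum-of-squares⇒∣ q≡3mod4 (toℕ A₁) (toℕ A₂) q∣s
                , ≡3mod4∣sum-of-squares⇒∣ q≡3mod4 (toℕ A₂) (toℕ A₁) (subst (q ∣_) (+-comm (toℕ A₁ * toℕ A₁) _) q∣s)
  ... | no  q∤s = ⊥-elim (y≢0 (cong₂ _,_ (killed-by-unit C q∤s (proj₁ (norm-kills a y ay≡0)))
                                         (killed-by-unit D q∤s (proj₂ (norm-kills a y ay≡0)))))

  open RelationGraph _≟Zi_ (λ x y → x · y ≡ zeroZi) (λ x y → (x · y) ≟Zi zeroZi)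
                     (λ {x} {y} xy≡0 → trans (·-comm y x) xy≡0) IsNonzeroZeroDivisor

  vertex∈ideal : (v : Vertex) → InIdeal (proj₁ v)
  vertex∈ideal (a , _ , y , y≢0 , ay≡0) = zeroDivisor∈ideal a y y≢0 ay≡0

  u u′ : Vertex
  u  = u₀  , u₀≢0  , u₀ , u₀≢0 , u₀-annihilates u₀ u₀∈ideal
  u′ = u₀′ , u₀′≢0 , u₀ , u₀≢0 , u₀′-annihilates u₀ u₀∈ideal

  open UniversalPair u u′ u₀≢u₀′ (λ v → u₀-annihilates (proj₁ v) (vertex∈ideal v))
                                  (λ v → u₀′-annihilates (proj₁ v) (vertex∈ideal v))

  Candidate : Zi → Set
  Candidate w = InIdeal w × w ≢ zeroZi × w ≢ u₀ × w ≢ u₀′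

  candidate? : ∀ w → Dec (Candidate w)
  candidate? w@(a , b) =
    ((q ∣? toℕ a) ×-dec (q ∣? toℕ b)) ×-dec ¬? (w ≟Zi zeroZi) ×-dec ¬? (w ≟Zi u₀) ×-dec ¬? (w ≟Zi u₀′)

  asVertex : ∀ w → Candidate w → Vertex
  asVertex w (w∈ideal , w≢0 , _) = w , w≢0 , u₀ , u₀≢0 , trans (·-comm w u₀) (u₀-annihilates w w∈ideal)

  candidates : List Zi → List Vertex
  candidates []       = []
  candidates (w ∷ ws) with candidate? w
  ... | yes w-cand = asVertex w w-cand ∷ candidates ws
  ... | no  _      = candidates ws

  candidates-are : ∀ ws → All (Candidate ∘ proj₁) (candidates ws)
  candidates-are []       = []
  candidates-are (w ∷ ws) with candidate? w
  ... | yes w-cand = w-cand ∷ candidates-are ws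
  ... | no  _      = candidates-are ws

  candidates-⊆ : ∀ {P : Zi → Set} {ws} → All P ws → All (P ∘ proj₁) (candidates ws)
  candidates-⊆         []         = []
  candidates-⊆ {ws = w ∷ _} (pw ∷ pws) with candidate? w
  ... | yes _ = pw ∷ candidates-⊆ pws
  ... | no  _ = candidates-⊆ pws

  candidates-distinct : ∀ {ws} → Unique ws → DistinctVertices (candidates ws)
  candidates-distinct                 []            = []
  candidates-distinct {ws = w ∷ _} (w∉ws ∷ uws) with candidate? w
  ... | yes _ = candidates-⊆ w∉ws ∷ candidates-distinct uws
  ... | no  _ = candidates-distinct uws

  candidates-complete : ∀ {w} ws → w ∈ ws → Candidate w → w ∈⌊ candidates ws ⌋
  candidates-complete {w} (w′ ∷ ws) (here refl) w-cand with candidate? w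
  ... | yes _      = here refl
  ... | no  ¬cand  = ⊥-elim (¬cand w-cand)
  candidates-complete (w′ ∷ ws) (there w∈ws) w-cand with candidate? w′
  ... | yes _ = there (candidates-complete ws w∈ws w-cand)
  ... | no  _ = candidates-complete ws w∈ws w-cand

  elements : List Zi
  elements = cartesianProduct (allFin n) (allFin n)

  X : List Vertex
  X = candidates elements

  X-complete : (v : Vertex) → NonHub v → proj₁ v ∈⌊ X ⌋
  X-complete v (v≢u₀ , v≢u₀′) = candidates-complete elements (∈-cartesianProduct⁺ (∈-allFin _) (∈-allFin _))
                                  (vertex∈ideal v , proj₁ (proj₂ v) , v≢u₀ , v≢u₀′)

  X-nonempty : 1 ≤ length X
  X-nonempty = occupied (X-complete (Q+Qi , [Q]≢0 ∘ cong proj₁ , u₀ , u₀≢0 , Q+Qi·u₀≡0)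
                                    ([Q]≢0 ∘ cong proj₂ , [Q]≢0 ∘ cong proj₁))
    where
    Q+Qi : Zi
    Q+Qi = [ Q ] , [ Q ]
    Q+Qi·u₀≡0 : Q+Qi · u₀ ≡ zeroZi
    Q+Qi·u₀≡0 = trans (·-comm Q+Qi u₀) (u₀-annihilates Q+Qi (proj₁ u₀∈ideal , proj₁ u₀∈ideal))
    occupied : ∀ {a S} → a ∈⌊ S ⌋ → 1 ≤ length S
    occupied (here _)  = s≤s z≤n
    occupied (there _) = s≤s z≤n

  lineGraph-pancyclic : Pancyclic (LineGraph (ZeroDivGraph n))
  lineGraph-pancyclic =
    pancyclic X (candidates-distinct (Unique.cartesianProduct⁺ (Unique.allFin⁺ n) (Unique.allFin⁺ n)))
              (All.map (λ (_ , _ , w≢u₀ , w≢u₀′) → w≢u₀ , w≢u₀′) (candidates-are elements))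
              X-complete X-nonempty

theorem3p8 : (q m : ℕ) (q-prime : Prime q) → q % 4 ≡ 3 → 2 ≤ m →
    Pancyclic (LineGraph (ZeroDivGraph (q ^ m) {{m^n≢0 q m {{prime⇒nonZero q-prime}}}}))
theorem3p8 zero        m             _       ()
theorem3p8 (suc q-1)   (suc (suc k)) q-prime q%4≡3 (s≤s (s≤s _)) =
  GaussianIntegersModPrimePower.lineGraph-pancyclic {q-1} {k} q-prime q%4≡3
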